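{- Let $G=(X,Y,E)$ be a 2-layer network in which every vertex of $Y$ has degree at least $1$, let $<_X$ be a linear order of $X$ such that the one-sided local crossing number of $(G,<_X)$ is $k$, and let $<_{\mathsf A}$ be any order of $Y$ that can be returned by heuristic $\mathsf A$. Then every light edge crosses at most $3k$ edges in the 2-layer drawing $(<_X,<_{\mathsf A})$.
   Context: A 2-layer network $(X,Y,E)$ is a finite bipartite graph with vertex set $X\cup Y$, $X\cap Y=\emptyset$, edges written $(x,y)$ with $x\in X,y\in Y$. A 2-layer drawing is a pair $(<_X,<_Y)$ of linear orders of $X$ and $Y$; edges $(x_1,y_1),(x_2,y_2)$ cross iff $(x_1<_X x_2\wedge y_2<_Y y_1)$ or $(x_2<_X x_1\wedge y_1<_Y y_2)$. The local crossing number of a drawing is the minimum $k$ such that every edge crosses at most $k$ edges; the one-sided local crossing number of $(G,<_X)$ is the minimum over all linear orders $<_Y$ of $Y$ of the local crossing number of $(<_X,<_Y)$. Heuristic $\mathsf A$: for each $y\in Y$ list its neighbors in increasing $<_X$ order (1-indexed). The median $\mathrm{med}(y)$ is the 2nd neighbor if $\deg(y)=2$, and the $\lfloor \deg(y)/2\rfloor$-th neighbor if $\deg(y)\neq 2$. The edge $(\mathrm{med}(y),y)$ is a median edge. Call $y$ a 2-vertex if $\deg(y)=2$, an odd vertex if $\deg(y)$ is odd, and a $4^{\oplus}$-vertex if $\deg(y)$ is even and at least $4$. For a 2-vertex $y$, its heavy neighbor is its neighbor $w$ other than $\mathrm{med}(y)$, and $(w,y)$ is a heavy edge. An edge that is neither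 a median edge nor a heavy edge is a light edge. The bunch of $x\in X$ is $\{y\in Y:\mathrm{med}(y)=x\}$. The output $<_{\mathsf A}$ is a linear order of $Y$ with $y_1<_{\mathsf A}y_2$ whenever $\mathrm{med}(y_1)<_X\mathrm{med}(y_2)$, and within each bunch: first the 2-vertices in ascending $<_X$-order of their heavy neighbors (ties broken arbitrarily), then the odd vertices in any order, then the $4^{\oplus}$-vertices in ascending order of degree (ties broken arbitrarily). -}

module Defs where

open import Data.Nat using (ℕ; zero; suc; _+_; _*_; _∸_; _≤_; _<_; ⌈_/2⌉)
open import Data.Bool using (Bool; true; false; _∧_; _∨_; if_then_else_; T)
open import Data.Fin using (Fin; toℕ)
import Data.Fin as F
open import Data.List using (List; []; _∷_; filter; length; drop; head; map; allFin)
open import Data.Nat.ListAction using (sum)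
open import Data.Bool.Properties using (T?)
open import Data.Maybe using (Maybe; just; nothing)
open import Data.Product using (_×_; ∃; Σ)
open import Data.Sum using (_⊎_)
open import Relation.Nullary using (¬_)
open import Relation.Nullary.Decidable using (⌊_⌋; does)
open import Relation.Binary.PropositionalEquality using (_≡_)
open import Function.Definitions using (Injective)

-- A 2-layer network: X = Fin m, Y = Fin n, edge relation E x y (x ∈ X, y ∈ Y).
-- The linear order <_X of X is identified with the natural order of Fin m
-- (X is labelled by its <_X-rank).
-- A linear order <_Y of Y is given by an injective position map
-- pos : Fin n → Fin n, with  y₁ <_Y y₂  iff  pos y₁ < pos y₂.

Network : ℕ → ℕ → Set
Network m n = Fin m → Fin n → Bool

OrderY : ℕ → Set
OrderY n = Σ (Fin n → Fin n) (λ pos → Injective _≡_ _≡_ pos)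

module _ {m n : ℕ} (E : Network m n) where

  nbrs : Fin n → List (Fin m)
  nbrs y = filter (λ x → T? (E x y)) (allFin m)

  deg : Fin n → ℕ
  deg y = length (nbrs y)

  -- the i-th neighbour (1-indexed), if it exists
  nthNbr : Fin n → ℕ → Maybe (Fin m)
  nthNbr y i = head (drop (i ∸ 1) (nbrs y))

  -- 1-indexed position of the median neighbour
  medIndex : ℕ → ℕ
  medIndex 2 = 2
  medIndex d = ⌈ d /2⌉

  med : Fin n → Maybe (Fin m)
  med y = nthNbr y (medIndex (deg y))

  -- heavy neighbour of a 2-vertex: the neighbour other than the median (= 1st)
  heavy : Fin n → Maybe (Fin m)
  heavy y = nthNbr y 1

  data Odd : ℕ → Set where
    one : Odd 1
    ss  : ∀ {k} → Odd k → Odd (suc (suc k))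

  data Even : ℕ → Set where
    zero : Even 0
    ss   : ∀ {k} → Even k → Even (suc (suc k))

  Is2Vertex : Fin n → Set
  Is2Vertex y = deg y ≡ 2

  IsOddVertex : Fin n → Set
  IsOddVertex y = Odd (deg y)

  Is4PlusVertex : Fin n → Set
  Is4PlusVertex y = Even (deg y) × 4 ≤ deg y

  IsMedianEdge : Fin m → Fin n → Set
  IsMedianEdge x y = T (E x y) × med y ≡ just x

  IsHeavyEdge : Fin m → Fin n → Set
  IsHeavyEdge x y = T (E x y) × Is2Vertex y × heavy y ≡ just x

  IsLightEdge : Fin m → Fin n → Set
  IsLightEdge x y = T (E x y) × ¬ IsMedianEdge x y × ¬ IsHeavyEdge x y

  crossesᵇ : (Fin n → Fin n) → Fin m → Fin n → Fin m → Fin n → Bool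
  crossesᵇ pos x₁ y₁ x₂ y₂ =
    (does (x₁ F.<? x₂) ∧ does (pos y₂ F.<? pos y₁))
    ∨ (does (x₂ F.<? x₁) ∧ does (pos y₁ F.<? pos y₂))

  crossingsOf : (Fin n → Fin n) → Fin m → Fin n → ℕ
  crossingsOf pos x y =
    sum (map (λ x₂ → sum (map (λ y₂ →
      if E x₂ y₂ ∧ crossesᵇ pos x y x₂ y₂ then 1 else 0) (allFin n))) (allFin m))

  LocalCrossingAtMost : (Fin n → Fin n) → ℕ → Set
  LocalCrossingAtMost pos k = ∀ x y → T (E x y) → crossingsOf pos x y ≤ k

  OneSidedLCN : ℕ → Set
  OneSidedLCN k =
    Σ (OrderY n) (λ o → LocalCrossingAtMost (Data.Product.proj₁ o) k)
    × (∀ (o : OrderY n) (j : ℕ) → LocalCrossingAtMost (Data.Product.proj₁ o) j → k ≤ j)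

  data ClassRank : Fin n → ℕ → Set where
    r2   : ∀ {y} → Is2Vertex y → ClassRank y 0
    rodd : ∀ {y} → IsOddVertex y → ClassRank y 1
    r4   : ∀ {y} → Is4PlusVertex y → ClassRank y 2

  IsAOrder : (Fin n → Fin n) → Set
  IsAOrder pos =
    (∀ y₁ y₂ x₁ x₂ → med y₁ ≡ just x₁ → med y₂ ≡ just x₂ →
       x₁ F.< x₂ → pos y₁ F.< pos y₂)
    × (∀ y₁ y₂ x r₁ r₂ → med y₁ ≡ just x → med y₂ ≡ just x →
       ClassRank y₁ r₁ → ClassRank y₂ r₂ → r₁ < r₂ → pos y₁ F.< pos y₂)
    × (∀ y₁ y₂ x h₁ h₂ → med y₁ ≡ just x → med y₂ ≡ just x →
       Is2Vertex y₁ → Is2Vertex y₂ → heavy y₁ ≡ just h₁ → heavy y₂ ≡ just h₂ →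
       h₁ F.< h₂ → pos y₁ F.< pos y₂)
    × (∀ y₁ y₂ x → med y₁ ≡ just x → med y₂ ≡ just x →
       Is4PlusVertex y₁ → Is4PlusVertex y₂ → deg y₁ < deg y₂ → pos y₁ F.< pos y₂)

module Submission where

-- Let (x, y) be a light edge and μ the median of y. Being neither the median nor
-- the heavy edge, (x, y) has a partner edge (z, y) with z on the other side of μ.
-- Fix an optimal order q of Y and any other vertex y₂, with median μ′. If y₂ lies
-- left of y in the A-order then μ′ ≤ μ, and the edges at y₂ crossing (x, y) are
-- those ending in b > x. If y₂ is left of y in q as well, they cross (x, y) in q.
-- Otherwise the edges at y₂ crossing (a, y) in q are those with b < a. When
-- z < μ < x, every b > x exceeds μ′, and since μ′ is a median there are at most as
-- many such b as b ≤ μ′ < x. When x < μ < z, the b < z cross (z, y) in q and the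
-- b ≥ z exceed μ′, so they are at most as many as the b ≤ μ′ < z. Mirror the
-- argument when y₂ lies right of y. Summing over y₂, the crossings of (x, y) are
-- at most those of (x, y) plus twice those of (z, y) under q, each at most k.

open import Defs
open import Data.Bool using (Bool; true; false; _∧_; if_then_else_; T)
open import Data.Bool.Properties using (T?; T-∧; T-∨)
open import Data.Empty using (⊥-elim)
open import Data.Fin using (Fin)
import Data.Fin as F
import Data.Fin.Properties as F
open import Data.List using (List; []; _∷_; _++_; length; filter; map; head; drop; allFin; tabulate)
open import Data.List.Membership.Propositional using (_∈_)
open import Data.List.Membership.Propositional.Properties using (∈-++⁺ʳ; ∈-++⁻; ∈-filter⁺; ∈-filter⁻; ∈-allFin)
open import Data.List.Properties using (length-++; length-filter; filter-++; filter-all; filter-none; map-cong; map-tabulate)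
open import Data.List.Relation.Unary.All as All using (All; []; _∷_)
open import Data.List.Relation.Unary.AllPairs using (AllPairs; []; _∷_)
import Data.List.Relation.Unary.AllPairs.Properties as AllPairs
open import Data.List.Relation.Unary.Any using (here; there)
open import Data.Maybe using (just)
open import Data.Nat using (ℕ; zero; suc; _+_; _*_; _∸_; _≤_; _<_; z≤n; s≤s; ⌈_/2⌉; ⌊_/2⌋)
open import Data.Nat.ListAction using (sum)
open import Data.Nat.Properties
open import Algebra.Properties.Semiring.Sum +-*-semiring
  using (sum-syntax; ∑-comm; ∑-distrib-+; sum-cong-≗; *-distribˡ-sum)
open import Data.Product using (_×_; _,_; proj₁; proj₂; ∃; ∃₂; map₂)
open import Data.Product.Function.NonDependent.Propositional using (_×-⇔_)
open import Data.Sum using (_⊎_; inj₁; inj₂; [_,_]′)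
import Data.Sum as Sum
open import Data.Sum.Function.Propositional using (_⊎-⇔_)
open import Data.Unit using (tt)
open import Function using (_∘_; flip; id)
open import Function.Bundles using (_⇔_; mk⇔; module Equivalence)
open import Function.Definitions using (Injective)
open import Function.Properties.Equivalence using () renaming (trans to ⇔-trans)
open import Level using (Level; 0ℓ)
open import Relation.Binary using (Rel; IsStrictTotalOrder; tri<; tri≈; tri>)
import Relation.Binary as B
import Relation.Binary.Construct.Flip.EqAndOrd as Flip
open import Relation.Binary.PropositionalEquality
  using (_≡_; _≢_; refl; sym; trans; cong; cong₂; subst; subst₂; module ≡-Reasoning)
open import Relation.Nullary using (¬_; Dec; does; yes; no)
open import Relation.Nullary.Negation using (contradiction)
open import Relation.Unary using (Pred; Decidable; ∁)
open import Relation.Unary.Properties using (∁?)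

open Equivalence using (to; from)

module _ {a : Level} {A : Set a} where

  count : ∀ {p} {P : Pred A p} → Decidable P → List A → ℕ
  count P? = length ∘ filter P?

  module _ {p : Level} {P : Pred A p} (P? : Decidable P) where

    count-++ : ∀ xs ys → count P? (xs ++ ys) ≡ count P? xs + count P? ys
    count-++ xs ys = trans (cong length (filter-++ P? xs ys)) (length-++ (filter P? xs))

    count-all : ∀ {xs} → All P xs → count P? xs ≡ length xs
    count-all = cong length ∘ filter-all P?

    count-none : ∀ {xs} → All (∁ P) xs → count P? xs ≡ 0
    count-none = cong length ∘ filter-none P?

    count+count-∁≡length : ∀ xs → count P? xs + count (∁? P?) xs ≡ length xs
    count+count-∁≡length [] = refl
    count+count-∁≡length (x ∷ xs) with P? x
    ... | yes _ = cong suc (count+count-∁≡length xs)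
    ... | no _  = trans (+-suc _ _) (cong suc (count+count-∁≡length xs))

    module _ {q : Level} {Q : Pred A q} (Q? : Decidable Q) where

      count-mono : (∀ {x} → P x → Q x) → ∀ xs → count P? xs ≤ count Q? xs
      count-mono P⇒Q [] = z≤n
      count-mono P⇒Q (x ∷ xs) with P? x | Q? x
      ... | yes _  | yes _  = s≤s (count-mono P⇒Q xs)
      ... | yes px | no ¬qx = ⊥-elim (¬qx (P⇒Q px))
      ... | no _   | yes _  = m≤n⇒m≤1+n (count-mono P⇒Q xs)
      ... | no _   | no _   = count-mono P⇒Q xs

  split-at : ∀ (xs : List A) j → j < length xs →
             ∃ λ μ → ∃₂ λ ys zs → xs ≡ ys ++ μ ∷ zs × length ys ≡ j × head (drop j xs) ≡ just μ
  split-at (x ∷ xs) zero    _       = x , [] , xs , refl , refl , refl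
  split-at (x ∷ xs) (suc j) (s≤s j<) with split-at xs j j<
  ... | μ , ys , zs , xs≡ , ys-len , μ-at-j = μ , x ∷ ys , zs , cong (x ∷_) xs≡ , cong suc ys-len , μ-at-j

module _ {a r : Level} {A : Set a} {R : Rel A r} where

  AllPairs-++-∷⁻ : ∀ xs {μ ys} → AllPairs R (xs ++ μ ∷ ys) → All (λ x → R x μ) xs × All (R μ) ys
  AllPairs-++-∷⁻ []       (μRys ∷ _) = [] , μRys
  AllPairs-++-∷⁻ (x ∷ xs) (xRs ∷ sorted) with AllPairs-++-∷⁻ xs sorted
  ... | xsRμ , μRys = (All.lookup xRs (∈-++⁺ʳ xs (here refl)) ∷ xsRμ) , μRys

-- The decision procedure is a separate parameter, rather than the one derived from
-- ≺-sto, so that for the reversed order of Fin it can be flip _<?_, whose counts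
-- are literally those of count-below-balanced.
module _ {a ℓ : Level} {A : Set a} {_≺_ : Rel A ℓ}
         (≺-sto : IsStrictTotalOrder _≡_ _≺_) (_≺?_ : B.Decidable _≺_) where

  open IsStrictTotalOrder ≺-sto using (compare) renaming (trans to ≺-trans)

  ≮-≺-trans : ∀ {u v w} → ¬ v ≺ u → v ≺ w → u ≺ w
  ≮-≺-trans {u} {w = w} v⊀u v≺w with compare u w
  ... | tri< u≺w _ _  = u≺w
  ... | tri≈ _ refl _ = ⊥-elim (v⊀u v≺w)
  ... | tri> _ _ w≺u  = ⊥-elim (v⊀u (≺-trans v≺w w≺u))

  ≺-≮-trans : ∀ {u v w} → u ≺ v → ¬ w ≺ v → u ≺ w
  ≺-≮-trans {u} {w = w} u≺v w⊀v with compare u w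
  ... | tri< u≺w _ _  = u≺w
  ... | tri≈ _ refl _ = ⊥-elim (w⊀v u≺v)
  ... | tri> _ _ w≺u  = ⊥-elim (w⊀v (≺-trans w≺u u≺v))

  count-after-bound : ∀ {μ′ μ x z} bs →
    count (μ′ ≺?_) bs ≤ count (∁? (μ′ ≺?_)) bs → ¬ μ ≺ μ′ → μ ≺ x ⊎ μ ≺ z →
    count (x ≺?_) bs ≤ count (_≺? x) bs + 2 * count (_≺? z) bs
  count-after-bound {μ′} {x = x} {z} bs balanced μ⊀μ′ (inj₁ μ≺x) = begin
    count (x ≺?_) bs                         ≤⟨ count-mono (x ≺?_) (μ′ ≺?_) (≺-trans μ′≺x) bs ⟩
    count (μ′ ≺?_) bs                        ≤⟨ balanced ⟩
    count (∁? (μ′ ≺?_)) bs                   ≤⟨ count-mono (∁? (μ′ ≺?_)) (_≺? x) (λ μ′⊀b → ≮-≺-trans μ′⊀b μ′≺x) bs ⟩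
    count (_≺? x) bs                         ≤⟨ m≤m+n _ _ ⟩
    count (_≺? x) bs + 2 * count (_≺? z) bs  ∎
    where
    open ≤-Reasoning
    μ′≺x : μ′ ≺ x
    μ′≺x = ≮-≺-trans μ⊀μ′ μ≺x
  count-after-bound {μ′} {x = x} {z} bs balanced μ⊀μ′ (inj₂ μ≺z) = begin
    count (x ≺?_) bs                          ≤⟨ length-filter (x ≺?_) bs ⟩
    length bs                                 ≡⟨ count+count-∁≡length (_≺? z) bs ⟨
    count (_≺? z) bs + count (∁? (_≺? z)) bs  ≤⟨ +-monoʳ-≤ (count (_≺? z) bs) not-before-z ⟩
    count (_≺? z) bs + count (_≺? z) bs       ≡⟨ cong (count (_≺? z) bs +_) (+-identityʳ _) ⟨
    2 * count (_≺? z) bs                      ≤⟨ m≤n+m _ (count (_≺? x) bs) ⟩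
    count (_≺? x) bs + 2 * count (_≺? z) bs   ∎
    where
    open ≤-Reasoning
    μ′≺z : μ′ ≺ z
    μ′≺z = ≮-≺-trans μ⊀μ′ μ≺z
    not-before-z : count (∁? (_≺? z)) bs ≤ count (_≺? z) bs
    not-before-z = begin
      count (∁? (_≺? z)) bs   ≤⟨ count-mono (∁? (_≺? z)) (μ′ ≺?_) (≺-≮-trans μ′≺z) bs ⟩
      count (μ′ ≺?_) bs       ≤⟨ balanced ⟩
      count (∁? (μ′ ≺?_)) bs  ≤⟨ count-mono (∁? (μ′ ≺?_)) (_≺? z) (λ μ′⊀b → ≮-≺-trans μ′⊀b μ′≺z) bs ⟩
      count (_≺? z) bs        ∎

T-does : ∀ {p} {P : Set p} (P? : Dec P) → T (does P?) ⇔ P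
T-does (yes p) = mk⇔ (λ _ → p) (λ _ → tt)
T-does (no ¬p) = mk⇔ (λ ()) ¬p

sum-map-allFin : ∀ {n} (f : Fin n → ℕ) → sum (map f (allFin n)) ≡ ∑[ i < n ] f i
sum-map-allFin f = trans (cong sum (map-tabulate id f)) (sum-tabulate f)
  where
  sum-tabulate : ∀ {n} (f : Fin n → ℕ) → sum (tabulate f) ≡ ∑[ i < n ] f i
  sum-tabulate {zero}  f = refl
  sum-tabulate {suc n} f = cong (f F.zero +_) (sum-tabulate (f ∘ F.suc))

∑-mono-≤ : ∀ {n} {f g : Fin n → ℕ} → (∀ i → f i ≤ g i) → ∑[ i < n ] f i ≤ ∑[ i < n ] g i
∑-mono-≤ {zero}  f≤g = z≤n
∑-mono-≤ {suc n} f≤g = +-mono-≤ (f≤g F.zero) (∑-mono-≤ (f≤g ∘ F.suc))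

sum-map-indicator : ∀ {a} {A : Set a} (P Q : A → Bool) xs →
  sum (map (λ x → if P x ∧ Q x then 1 else 0) xs) ≡ count (T? ∘ Q) (filter (T? ∘ P) xs)
sum-map-indicator P Q [] = refl
sum-map-indicator P Q (x ∷ xs) with P x
... | false = sum-map-indicator P Q xs
... | true with Q x
...   | true  = cong suc (sum-map-indicator P Q xs)
...   | false = sum-map-indicator P Q xs

m≡⌊m+n/2⌋⇒m≤n≤1+m : ∀ m n → m ≡ ⌊ (m + n) /2⌋ → m ≤ n × n ≤ suc m
m≡⌊m+n/2⌋⇒m≤n≤1+m m n m≡⌊s/2⌋ =
    subst₂ _≤_ (sym m≡⌊s/2⌋) (sym n≡⌈s/2⌉) (⌊n/2⌋≤⌈n/2⌉ s)
  , subst₂ _≤_ (sym n≡⌈s/2⌉) (cong suc (sym m≡⌊s/2⌋)) ⌈s/2⌉≤1+⌊s/2⌋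
  where
  s = m + n
  n≡⌈s/2⌉ : n ≡ ⌈ s /2⌉
  n≡⌈s/2⌉ = +-cancelˡ-≡ m n ⌈ s /2⌉ (begin
    m + n              ≡⟨ ⌊n/2⌋+⌈n/2⌉≡n s ⟨
    ⌊ s /2⌋ + ⌈ s /2⌉  ≡⟨ cong (_+ ⌈ s /2⌉) m≡⌊s/2⌋ ⟨
    m + ⌈ s /2⌉        ∎)
    where open ≡-Reasoning
  -- ⌈ s /2⌉ is ⌊ 1 + s /2⌋ by definition.
  ⌈s/2⌉≤1+⌊s/2⌋ : ⌈ s /2⌉ ≤ suc ⌊ s /2⌋
  ⌈s/2⌉≤1+⌊s/2⌋ = ⌊n/2⌋-mono (n≤1+n (suc s))

module _ {m n : ℕ} (E : Network m n) where

  ∈-nbrs⁺ : ∀ {x y} → T (E x y) → x ∈ nbrs E y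
  ∈-nbrs⁺ {x} {y} = ∈-filter⁺ (λ x → T? (E x y)) (∈-allFin x)

  ∈-nbrs⁻ : ∀ {x y} → x ∈ nbrs E y → T (E x y)
  ∈-nbrs⁻ {y = y} = proj₂ ∘ ∈-filter⁻ (λ x → T? (E x y)) {xs = allFin m}

  nbrs-sorted : ∀ y → AllPairs F._<_ (nbrs E y)
  nbrs-sorted y = AllPairs.filter⁺ (λ x → T? (E x y)) (AllPairs.tabulate⁺-< id)

  medIndex∸1< : ∀ d → 1 ≤ d → medIndex E d ∸ 1 < d
  medIndex∸1< 1                   _ = s≤s z≤n
  medIndex∸1< 2                   _ = s≤s (s≤s z≤n)
  medIndex∸1< (suc (suc (suc d))) _ = m≤n⇒m≤1+n (s≤s (⌈n/2⌉≤n (suc d)))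

  medIndex-balanced : ∀ a b → a ≡ medIndex E (a + suc b) ∸ 1 → a ≤ suc b × b ≤ suc a
  medIndex-balanced a b = by-degree (a + suc b) a b refl
    where
    by-degree : ∀ d a b → a + suc b ≡ d → a ≡ medIndex E d ∸ 1 → a ≤ suc b × b ≤ suc a
    by-degree 1 0 0 refl refl = z≤n , z≤n
    by-degree 2 1 0 refl refl = s≤s z≤n , z≤n
    -- Here medIndex E (3 + d) ∸ 1 = ⌈ 3 + d /2⌉ ∸ 1 reduces to ⌊ 2 + d /2⌋.
    by-degree (suc (suc (suc d))) a b a+1+b≡3+d a≡⌊2+d/2⌋ =
      let a≤b , b≤1+a = m≡⌊m+n/2⌋⇒m≤n≤1+m a b (trans a≡⌊2+d/2⌋ (cong ⌊_/2⌋ (sym a+b≡2+d)))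
      in  m≤n⇒m≤1+n a≤b , b≤1+a
      where
      a+b≡2+d : a + b ≡ suc (suc d)
      a+b≡2+d = suc-injective (trans (sym (+-suc a b)) a+1+b≡3+d)

  record MedianSplit (y : Fin n) : Set where
    field
      median       : Fin m
      below above  : List (Fin m)
      nbrs≡        : nbrs E y ≡ below ++ median ∷ above
      med≡         : med E y ≡ just median
      -- In terms of the lengths rather than deg E y, so that it computes on concrete shapes.
      length-below : length below ≡ medIndex E (length below + suc (length above)) ∸ 1

    balanced : length below ≤ suc (length above) × length above ≤ suc (length below)
    balanced = medIndex-balanced (length below) (length above) length-below

    sorted : All (F._< median) below × All (median F.<_) above
    sorted = AllPairs-++-∷⁻ below (subst (AllPairs F._<_) nbrs≡ (nbrs-sorted y))

    private
      below<median = proj₁ sorted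
      median<above = proj₂ sorted

      median≮median : ¬ median F.< median
      median≮median = F.<-irrefl refl

      median≮below : All (λ b → ¬ median F.< b) below
      median≮below = All.map F.<-asym below<median

      above≮median : All (λ b → ¬ b F.< median) above
      above≮median = All.map F.<-asym median<above

      count-split : ∀ {P : Pred (Fin m) 0ℓ} (P? : Decidable P) →
        count P? (nbrs E y) ≡ count P? below + (count P? (median ∷ []) + count P? above)
      count-split P? = begin
        count P? (nbrs E y)                                         ≡⟨ cong (count P?) nbrs≡ ⟩
        count P? (below ++ median ∷ above)                          ≡⟨ count-++ P? below (median ∷ above) ⟩
        count P? below + count P? (median ∷ above)                  ≡⟨ cong (count P? below +_) (count-++ P? (median ∷ []) above) ⟩
        count P? below + (count P? (median ∷ []) + count P? above)  ∎
        where open ≡-Reasoning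

    count-below-balanced : count (F._<? median) (nbrs E y) ≤ count (∁? (F._<? median)) (nbrs E y)
    count-below-balanced = begin
      count <μ? (nbrs E y)
        ≡⟨ count-split <μ? ⟩
      _ ≡⟨ cong₂ _+_ (count-all <μ? below<median)
                     (cong₂ _+_ (count-none <μ? (median≮median ∷ [])) (count-none <μ? above≮median)) ⟩
      length below + 0
        ≡⟨ +-identityʳ _ ⟩
      length below
        ≤⟨ proj₁ balanced ⟩
      suc (length above)
        ≡⟨ cong₂ _+_ (count-none (∁? <μ?) (All.map contradiction below<median))
                     (cong₂ _+_ (count-all (∁? <μ?) (median≮median ∷ []))
                                (count-all (∁? <μ?) above≮median)) ⟨
      _ ≡⟨ count-split (∁? <μ?) ⟨
      count (∁? <μ?) (nbrs E y)
        ∎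
      where
      open ≤-Reasoning
      <μ? = F._<? median

    count-above-balanced : count (median F.<?_) (nbrs E y) ≤ count (∁? (median F.<?_)) (nbrs E y)
    count-above-balanced = begin
      count μ<? (nbrs E y)
        ≡⟨ count-split μ<? ⟩
      _ ≡⟨ cong₂ _+_ (count-none μ<? median≮below)
                     (cong₂ _+_ (count-none μ<? (median≮median ∷ [])) (count-all μ<? median<above)) ⟩
      length above
        ≤⟨ proj₂ balanced ⟩
      suc (length below)
        ≡⟨ +-comm 1 _ ⟩
      length below + 1
        ≡⟨ cong₂ _+_ (count-all (∁? μ<?) median≮below)
                     (cong₂ _+_ (count-all (∁? μ<?) (median≮median ∷ []))
                                (count-none (∁? μ<?) (All.map contradiction median<above))) ⟨
      _ ≡⟨ count-split (∁? μ<?) ⟨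
      count (∁? μ<?) (nbrs E y)
        ∎
      where
      open ≤-Reasoning
      μ<? = median F.<?_

  median-split : ∀ y → 1 ≤ deg E y → MedianSplit y
  median-split y deg≥1 with split-at (nbrs E y) (medIndex E (deg E y) ∸ 1) (medIndex∸1< (deg E y) deg≥1)
  ... | μ , below , above , nbrs≡ , length-below , med≡ = record
    { median = μ ; below = below ; above = above ; nbrs≡ = nbrs≡ ; med≡ = med≡
    ; length-below = trans length-below (cong (λ d → medIndex E d ∸ 1) (trans (cong length nbrs≡) (length-++ below)))
    }

  open MedianSplit

  neighbour-below-median : ∀ {x y} (s : MedianSplit y) → x ∈ above s →
                           ∃ λ z → T (E z y) × z F.< median s × median s F.< x
  neighbour-below-median record { below = [] ; above = _ ∷ []    ; length-below = () } _
  neighbour-below-median record { below = [] ; above = _ ∷ _ ∷ _ ; length-below = () } _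
  neighbour-below-median s@record { below = b ∷ _ } x∈above =
    b , ∈-nbrs⁻ (subst (b ∈_) (sym (nbrs≡ s)) (here refl))
      , All.head (proj₁ (sorted s)) , All.lookup (proj₂ (sorted s)) x∈above

  neighbour-above-median : ∀ {x y} (s : MedianSplit y) → x ∈ below s → ¬ IsHeavyEdge E x y →
                           ∃ λ z → T (E z y) × x F.< median s × median s F.< z
  neighbour-above-median s@record { above = a ∷ _ } x∈below _ =
    a , ∈-nbrs⁻ (subst (a ∈_) (sym (nbrs≡ s)) (∈-++⁺ʳ (below s) (there (here refl))))
      , All.lookup (proj₁ (sorted s)) x∈below , All.head (proj₂ (sorted s))
  neighbour-above-median s@record { below = _ ∷ _ ∷ _ ; above = [] } _ _ with proj₁ (balanced s)
  ... | s≤s ()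
  neighbour-above-median s@record { below = _ ∷ [] ; above = [] } (here refl) ¬heavy-edge =
    ⊥-elim (¬heavy-edge ( ∈-nbrs⁻ (subst (_ ∈_) (sym (nbrs≡ s)) (here refl))
                        , cong length (nbrs≡ s) , cong head (nbrs≡ s)))

  OppositeSides : Fin m → Fin m → Fin m → Set
  OppositeSides μ x z = (x F.< μ × μ F.< z) ⊎ (z F.< μ × μ F.< x)

  light-edge-straddles : ∀ {x y} → IsLightEdge E x y → (s : MedianSplit y) →
                         ∃ λ z → T (E z y) × OppositeSides (median s) x z
  light-edge-straddles {x} (Exy , ¬median-edge , ¬heavy-edge) s
    with ∈-++⁻ (below s) (subst (x ∈_) (nbrs≡ s) (∈-nbrs⁺ Exy))
  ... | inj₂ (here refl)     = ⊥-elim (¬median-edge (Exy , med≡ s))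
  ... | inj₂ (there x∈above) = map₂ (map₂ inj₂) (neighbour-below-median s x∈above)
  ... | inj₁ x∈below         = map₂ (map₂ inj₁) (neighbour-above-median s x∈below ¬heavy-edge)

  crossingCount : (Fin n → Fin n) → Fin m → Fin n → Fin n → ℕ
  crossingCount pos x y y₂ = count (λ b → T? (crossesᵇ E pos x y b y₂)) (nbrs E y₂)

  crossingsOf≡∑crossingCount : ∀ pos x y → crossingsOf E pos x y ≡ ∑[ y₂ < n ] crossingCount pos x y y₂
  crossingsOf≡∑crossingCount pos x y = begin
    crossingsOf E pos x y                            ≡⟨ cong sum (map-cong (λ b → sum-map-allFin (c b)) (allFin m)) ⟩
    sum (map (λ b → ∑[ y₂ < n ] c b y₂) (allFin m))  ≡⟨ sum-map-allFin (λ b → ∑[ y₂ < n ] c b y₂) ⟩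
    ∑[ b < m ] ∑[ y₂ < n ] c b y₂                    ≡⟨ ∑-comm c ⟩
    ∑[ y₂ < n ] ∑[ b < m ] c b y₂                    ≡⟨ sum-cong-≗ edges-at ⟩
    ∑[ y₂ < n ] crossingCount pos x y y₂             ∎
    where
    open ≡-Reasoning
    c : Fin m → Fin n → ℕ
    c b y₂ = if E b y₂ ∧ crossesᵇ E pos x y b y₂ then 1 else 0
    edges-at : ∀ y₂ → ∑[ b < m ] c b y₂ ≡ crossingCount pos x y y₂
    edges-at y₂ = trans (sym (sum-map-allFin (λ b → c b y₂)))
                        (sum-map-indicator (λ b → E b y₂) (λ b → crossesᵇ E pos x y b y₂) (allFin m))

  T-crossesᵇ : ∀ pos x₁ y₁ x₂ y₂ → T (crossesᵇ E pos x₁ y₁ x₂ y₂) ⇔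
               ((x₁ F.< x₂ × pos y₂ F.< pos y₁) ⊎ (x₂ F.< x₁ × pos y₁ F.< pos y₂))
  T-crossesᵇ pos x₁ y₁ x₂ y₂ =
    ⇔-trans T-∨ (⇔-trans T-∧ (T-does (x₁ F.<? x₂) ×-⇔ T-does (pos y₂ F.<? pos y₁))
             ⊎-⇔ ⇔-trans T-∧ (T-does (x₂ F.<? x₁) ×-⇔ T-does (pos y₁ F.<? pos y₂)))

  module _ {pos : Fin n → Fin n} {y y₂ : Fin n} where

    crossesᵇ-left : pos y₂ F.< pos y → ∀ {a b} → T (crossesᵇ E pos a y b y₂) ⇔ a F.< b
    crossesᵇ-left y₂<y {a} {b} = mk⇔
      ([ proj₁ , (λ (_ , y<y₂) → ⊥-elim (F.<-asym y₂<y y<y₂)) ]′ ∘ to (T-crossesᵇ pos a y b y₂))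
      (λ a<b → from (T-crossesᵇ pos a y b y₂) (inj₁ (a<b , y₂<y)))

    crossesᵇ-right : pos y F.< pos y₂ → ∀ {a b} → T (crossesᵇ E pos a y b y₂) ⇔ b F.< a
    crossesᵇ-right y<y₂ {a} {b} = mk⇔
      ([ (λ (_ , y₂<y) → ⊥-elim (F.<-asym y₂<y y<y₂)) , proj₁ ]′ ∘ to (T-crossesᵇ pos a y b y₂))
      (λ b<a → from (T-crossesᵇ pos a y b y₂) (inj₂ (b<a , y<y₂)))

    crossesᵇ-aligned : pos y₂ ≡ pos y → ∀ {a b} → ¬ T (crossesᵇ E pos a y b y₂)
    crossesᵇ-aligned y₂≡y {a} {b} c with to (T-crossesᵇ pos a y b y₂) c
    ... | inj₁ (_ , y₂<y) = F.<-irrefl y₂≡y y₂<y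
    ... | inj₂ (_ , y<y₂) = F.<-irrefl (sym y₂≡y) y<y₂

  module _ {p q : Fin n → Fin n} (q-injective : Injective _≡_ _≡_ q)
           (p-by-median : ∀ y₁ y₂ μ₁ μ₂ → med E y₁ ≡ just μ₁ → med E y₂ ≡ just μ₂ →
                          μ₁ F.< μ₂ → p y₁ F.< p y₂)
           {x y z μ} (med-y : med E y ≡ just μ) (x-z-opposite : OppositeSides μ x z) where

    oriented-crossingCount-bound :
      ∀ {ℓ} {_≺_ : Rel (Fin m) ℓ} (≺-sto : IsStrictTotalOrder _≡_ _≺_) (_≺?_ : B.Decidable _≺_) {y₂ μ′} →
      (∀ {b} → T (crossesᵇ E p x y b y₂) → x ≺ b) →
      (∀ {a b} → a ≺ b → T (crossesᵇ E q a y b y₂)) ⊎ (∀ {a b} → b ≺ a → T (crossesᵇ E q a y b y₂)) →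
      count (μ′ ≺?_) (nbrs E y₂) ≤ count (∁? (μ′ ≺?_)) (nbrs E y₂) → ¬ μ ≺ μ′ → μ ≺ x ⊎ μ ≺ z →
      crossingCount p x y y₂ ≤ crossingCount q x y y₂ + 2 * crossingCount q z y y₂
    oriented-crossingCount-bound _ _≺?_ {y₂} p-cross (inj₁ q-cross) _ _ _ =
      ≤-trans (count-mono _ _ (q-cross ∘ p-cross) (nbrs E y₂)) (m≤m+n _ _)
    oriented-crossingCount-bound ≺-sto _≺?_ {y₂} p-cross (inj₂ q-cross) balanced μ⊀μ′ beyond = begin
      crossingCount p x y y₂                               ≤⟨ count-mono _ (x ≺?_) p-cross bs ⟩
      count (x ≺?_) bs                                     ≤⟨ count-after-bound ≺-sto _≺?_ bs balanced μ⊀μ′ beyond ⟩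
      count (_≺? x) bs + 2 * count (_≺? z) bs              ≤⟨ +-mono-≤ (q-count x) (*-monoʳ-≤ 2 (q-count z)) ⟩
      crossingCount q x y y₂ + 2 * crossingCount q z y y₂  ∎
      where
      open ≤-Reasoning
      bs = nbrs E y₂
      q-count : ∀ a → count (_≺? a) bs ≤ crossingCount q a y y₂
      q-count a = count-mono (_≺? a) _ q-cross bs

    q-orientation : ∀ {y₂} → y₂ ≢ y →
      (∀ {a b} → a F.< b → T (crossesᵇ E q a y b y₂)) ⊎ (∀ {a b} → b F.< a → T (crossesᵇ E q a y b y₂))
    q-orientation {y₂} y₂≢y with F.<-cmp (q y₂) (q y)
    ... | tri< q₂<q _ _ = inj₁ (from (crossesᵇ-left {pos = q} q₂<q))
    ... | tri≈ _ q₂≡q _ = ⊥-elim (y₂≢y (q-injective q₂≡q))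
    ... | tri> _ _ q<q₂ = inj₂ (from (crossesᵇ-right {pos = q} q<q₂))

    crossingCount-bound : ∀ y₂ → MedianSplit y₂ →
      crossingCount p x y y₂ ≤ crossingCount q x y y₂ + 2 * crossingCount q z y y₂
    crossingCount-bound y₂ s with F.<-cmp (p y₂) (p y)
    ... | tri≈ _ p₂≡p _ = ≤-trans (≤-reflexive no-crossings) z≤n
      where
      no-crossings : crossingCount p x y y₂ ≡ 0
      no-crossings = count-none (λ b → T? (crossesᵇ E p x y b y₂))
                       (All.universal (λ b → crossesᵇ-aligned {pos = p} p₂≡p {x} {b}) (nbrs E y₂))
    ... | tri< p₂<p p₂≢p _ =
      oriented-crossingCount-bound F.<-isStrictTotalOrder F._<?_
        (to (crossesᵇ-left {pos = p} p₂<p)) (q-orientation (p₂≢p ∘ cong p)) (count-above-balanced s)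
        (λ μ<μ′ → F.<-asym p₂<p (p-by-median _ _ _ _ med-y (med≡ s) μ<μ′))
        (Sum.swap (Sum.map proj₂ proj₂ x-z-opposite))
    ... | tri> _ p₂≢p p<p₂ =
      oriented-crossingCount-bound (Flip.isStrictTotalOrder F.<-isStrictTotalOrder) (flip F._<?_)
        (to (crossesᵇ-right {pos = p} p<p₂)) (Sum.swap (q-orientation (p₂≢p ∘ cong p))) (count-below-balanced s)
        (λ μ′<μ → F.<-asym p<p₂ (p-by-median _ _ _ _ (med≡ s) med-y μ′<μ))
        (Sum.map proj₁ proj₁ x-z-opposite)

lemma7 : ∀ {m n : ℕ} (E : Network m n) (k : ℕ)
         → (∀ (y : Fin n) → 1 ≤ deg E y)
         → OneSidedLCN E k
         → (o : OrderY n)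
         → IsAOrder E (proj₁ o)
         → ∀ (x : Fin m) (y : Fin n)
         → IsLightEdge E x y
         → crossingsOf E (proj₁ o) x y ≤ 3 * k
lemma7 {n = n} E k deg≥1 (((q , q-injective) , q-within-k) , _) (p , _) (p-by-median , _) x y light
  with s ← median-split E y (deg≥1 y)
  with z , Ezy , x-z-opposite ← light-edge-straddles E light s = begin
  crossingsOf E p x y                              ≡⟨ crossingsOf≡∑crossingCount E p x y ⟩
  ∑[ y₂ < n ] crossingCount E p x y y₂             ≤⟨ ∑-mono-≤ per-vertex ⟩
  ∑[ y₂ < n ] (cq x y₂ + 2 * cq z y₂)              ≡⟨ ∑-distrib-+ (cq x) (λ y₂ → 2 * cq z y₂) ⟩
  ∑[ y₂ < n ] cq x y₂ + ∑[ y₂ < n ] (2 * cq z y₂)  ≡⟨ cong (∑[ y₂ < n ] cq x y₂ +_) (*-distribˡ-sum 2 (cq z)) ⟨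
  ∑[ y₂ < n ] cq x y₂ + 2 * ∑[ y₂ < n ] cq z y₂    ≤⟨ +-mono-≤ (q-total x (proj₁ light)) (*-monoʳ-≤ 2 (q-total z Ezy)) ⟩
  3 * k                                            ∎
  where
  open ≤-Reasoning
  cq : Fin _ → Fin n → ℕ
  cq a = crossingCount E q a y
  per-vertex : ∀ y₂ → crossingCount E p x y y₂ ≤ cq x y₂ + 2 * cq z y₂
  per-vertex y₂ = crossingCount-bound E q-injective p-by-median (MedianSplit.med≡ s) x-z-opposite
                    y₂ (median-split E y₂ (deg≥1 y₂))
  q-total : ∀ a → T (E a y) → ∑[ y₂ < n ] cq a y₂ ≤ k
  q-total a Eay = subst (_≤ k) (crossingsOf≡∑crossingCount E q a y) (q-within-k a y Eay)
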